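{- Let $k$ be an integer and let $\mathcal{A}_k$ be the set of all $k$-Arndt compositions (of all weights $n\ge0$). Then $$\sum_{\sigma\in\mathcal{A}_k}x^{|\sigma|}y^{\mathrm{parts}(\sigma)}=\begin{cases} \dfrac{(1 - x^2) (1 - x (1 - y))}{1 - x - x^2 + x^3 - x^{3 + k} y^2},& \text{if } k\geq 0,\\[2ex] \dfrac{(1 - x^2) (1 - x (1 - y))}{1 - x - x^2 (1 + y^2) + x^3 (1 - y^2) + y^2 x^{2 - k}},& \text{if } k< 0. \end{cases}$$
   Context: A composition of $n\ge0$ is a finite sequence $\sigma=(\sigma_1,\dots,\sigma_\ell)$ of positive integers summing to $n=|\sigma|$, with $\mathrm{parts}(\sigma)=\ell$ (the empty composition is the composition of $0$ with $0$ parts). For an integer $k$, a $k$-Arndt composition is a composition satisfying $\sigma_{2i-1}>\sigma_{2i}+k$ for every positive integer $i$ with $2i\le \ell$. -}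

module Defs where

open import Data.Nat as ℕ using (ℕ; zero; suc; _≟_)
open import Data.Integer as ℤ using (ℤ; +_; 0ℤ; 1ℤ)
open import Data.List using (List; []; _∷_; length; filter; map; concatMap; upTo)
open import Data.Nat.ListAction using (sum)
open import Data.Unit using (⊤; tt)
open import Data.Product using (_×_; _,_)
open import Relation.Nullary using (Dec; yes; no)
open import Relation.Nullary.Decidable using (_×-dec_)
open import Relation.Binary.PropositionalEquality using (_≡_)

-- A composition is represented as a list of positive naturals; its weight
-- |σ| is 'sum σ' and its number of parts is 'length σ'.

Arndt : ℤ → List ℕ → Set
Arndt k []            = ⊤
Arndt k (a ∷ [])      = ⊤
Arndt k (a ∷ b ∷ σ)   = ((+ b) ℤ.+ k ℤ.< + a) × Arndt k σ

arndt? : (k : ℤ) → (σ : List ℕ) → Dec (Arndt k σ)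
arndt? k []          = yes tt
arndt? k (a ∷ [])    = yes tt
arndt? k (a ∷ b ∷ σ) = ((+ b) ℤ.+ k ℤ.<? + a) ×-dec arndt? k σ

-- All lists of length ℓ with entries in {1,…,n}.  Every composition of n
-- with ℓ parts occurs exactly once in 'boxLists ℓ n'.
boxLists : ℕ → ℕ → List (List ℕ)
boxLists zero    n = [] ∷ []
boxLists (suc ℓ) n = concatMap (λ p → map (p ∷_) (boxLists ℓ n)) (map suc (upTo n))

arndtCount : ℤ → ℕ → ℕ → ℕ
arndtCount k n ℓ = length (filter (λ σ → (sum σ ≟ n) ×-dec arndt? k σ) (boxLists ℓ n))

-- Formal power series in two variables x, y with integer coefficients:
-- f n ℓ is the coefficient of x^n y^ℓ.

FPS : Set
FPS = ℕ → ℕ → ℤ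

_≈ₛ_ : FPS → FPS → Set
f ≈ₛ g = ∀ n ℓ → f n ℓ ≡ g n ℓ

infix 4 _≈ₛ_
infixl 6 _+ₛ_ _-ₛ_
infixl 7 _*ₛ_
infixr 8 _^ₛ_

sumTo : ℕ → (ℕ → ℤ) → ℤ
sumTo zero    f = f zero
sumTo (suc n) f = sumTo n f ℤ.+ f (suc n)

_+ₛ_ : FPS → FPS → FPS
(f +ₛ g) n ℓ = f n ℓ ℤ.+ g n ℓ

_-ₛ_ : FPS → FPS → FPS
(f -ₛ g) n ℓ = f n ℓ ℤ.- g n ℓ

_*ₛ_ : FPS → FPS → FPS
(f *ₛ g) n ℓ = sumTo n (λ i → sumTo ℓ (λ j → f i j ℤ.* g (n ℕ.∸ i) (ℓ ℕ.∸ j)))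

oneₛ : FPS
oneₛ zero zero = 1ℤ
oneₛ _    _    = 0ℤ

Xₛ : FPS
Xₛ (suc zero) zero = 1ℤ
Xₛ _          _    = 0ℤ

Yₛ : FPS
Yₛ zero (suc zero) = 1ℤ
Yₛ _    _          = 0ℤ

_^ₛ_ : FPS → ℕ → FPS
f ^ₛ zero  = oneₛ
f ^ₛ suc m = f *ₛ (f ^ₛ m)

arndtGF : ℤ → FPS
arndtGF k n ℓ = + arndtCount k n ℓ

numer : FPS
numer = (oneₛ -ₛ Xₛ ^ₛ 2) *ₛ (oneₛ -ₛ Xₛ *ₛ (oneₛ -ₛ Yₛ))

denomNonneg : ℕ → FPS
denomNonneg k = oneₛ -ₛ Xₛ -ₛ Xₛ ^ₛ 2 +ₛ Xₛ ^ₛ 3 -ₛ Xₛ ^ₛ (3 ℕ.+ k) *ₛ Yₛ ^ₛ 2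

-- Denominator for k < 0 (here m = -k = |k|):
-- 1 - x - x²(1 + y²) + x³(1 - y²) + y² x^{2-k}.
denomNeg : ℕ → FPS
denomNeg m = oneₛ -ₛ Xₛ -ₛ Xₛ ^ₛ 2 *ₛ (oneₛ +ₛ Yₛ ^ₛ 2) +ₛ Xₛ ^ₛ 3 *ₛ (oneₛ -ₛ Yₛ ^ₛ 2)
             +ₛ Yₛ ^ₛ 2 *ₛ Xₛ ^ₛ (2 ℕ.+ m)

{-# OPTIONS --safe #-}
-- A k-Arndt composition is a sequence of admissible pairs (a, b), a > b + k, followed by at
-- most one further part.  With P_k(x) = Σ x^(a+b) over admissible pairs, the coefficient rows
-- C_ℓ(x) of the generating function are therefore C_0 = 1, C_1 = x/(1 - x) and
-- C_(ℓ+2) = P_k C_ℓ.  Decreasing both parts of an admissible pair by one gives an admissible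
-- pair unless a part equals 1, so (1 - x²)P_k only counts pairs containing a 1 and
-- (1 - x)(1 - x²)P_k is x^(3+k) for k ≥ 0 and x² + x³ - x^(2-k) for k < 0.  Hence the
-- denominator is (1 - x)(1 - x²)(1 - y² P_k): multiplied by it, every row ℓ ≥ 2 cancels and
-- rows 0 and 1 give (1 - x)(1 - x²) + xy(1 - x²), the numerator.
module Submission where

open import Defs
open import Data.Integer using (ℤ; +_; 0ℤ; _≤_; _<_; ∣_∣)
open import Data.Product using (_×_)

open import Data.Bool using (if_then_else_)
open import Data.Integer using (1ℤ; -1ℤ; -[1+_]; _+_; _-_; _*_; -_; _<?_; +<+)
import Data.Integer.Properties as ℤP
open import Data.Integer.Solver using (module +-*-Solver)
open import Data.List using (List; []; _∷_; length; filter; map; concatMap; applyUpTo; upTo; _++_)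
import Data.List.Properties as ListP
open import Data.List.Relation.Unary.All using (universal)
open import Data.Nat as ℕ using (ℕ; zero; suc; z≤n; s≤s; _∸_; _≟_)
open import Data.Nat.ListAction using (sum)
import Data.Nat.Properties as ℕP
open import Data.Product using (_,_; proj₁; proj₂)
open import Data.Sum using (_⊎_; inj₁; inj₂)
open import Data.Unit using (tt)
open import Function using (_∘_; id; _⇔_; mk⇔; Equivalence)
open import Relation.Binary.PropositionalEquality
open import Relation.Nullary using (Dec; yes; no; does; ¬_; contradiction)
open import Relation.Nullary.Decidable using (_×-dec_)
open import Relation.Unary using (Pred; Decidable)
open +-*-Solver
open ≡-Reasoning

-- Indicators and finite sums

indicator : ∀ {p} {P : Set p} → Dec P → ℤ
indicator d = if does d then 1ℤ else 0ℤ

indicator-yes : ∀ {p} {P : Set p} (d : Dec P) → P → indicator d ≡ 1ℤ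
indicator-yes (yes _) _ = refl
indicator-yes (no ¬p) p = contradiction p ¬p

indicator-no : ∀ {p} {P : Set p} (d : Dec P) → ¬ P → indicator d ≡ 0ℤ
indicator-no (yes p) ¬p = contradiction p ¬p
indicator-no (no _)  _  = refl

indicator-cong : ∀ {p q} {P : Set p} {Q : Set q} (d : Dec P) (e : Dec Q) →
                 (P → Q) → (Q → P) → indicator d ≡ indicator e
indicator-cong (yes p) e to _    = sym (indicator-yes e (to p))
indicator-cong (no ¬p) e _  from = sym (indicator-no e (¬p ∘ from))

sumTo-cong : ∀ n {f g : ℕ → ℤ} → (∀ i → i ℕ.≤ n → f i ≡ g i) → sumTo n f ≡ sumTo n g
sumTo-cong zero    f≡g = f≡g 0 z≤n
sumTo-cong (suc n) f≡g =
  cong₂ _+_ (sumTo-cong n (λ i i≤n → f≡g i (ℕP.m≤n⇒m≤1+n i≤n))) (f≡g (suc n) ℕP.≤-refl)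

sumTo-zero : ∀ n {f : ℕ → ℤ} → (∀ i → i ℕ.≤ n → f i ≡ 0ℤ) → sumTo n f ≡ 0ℤ
sumTo-zero zero    f≡0 = f≡0 0 z≤n
sumTo-zero (suc n) f≡0 =
  cong₂ _+_ (sumTo-zero n (λ i i≤n → f≡0 i (ℕP.m≤n⇒m≤1+n i≤n))) (f≡0 (suc n) ℕP.≤-refl)

sumTo-+ : ∀ n (f g : ℕ → ℤ) → sumTo n (λ i → f i + g i) ≡ sumTo n f + sumTo n g
sumTo-+ zero    f g = refl
sumTo-+ (suc n) f g = begin
  sumTo n (λ i → f i + g i) + (f (suc n) + g (suc n))
    ≡⟨ cong (_+ (f (suc n) + g (suc n))) (sumTo-+ n f g) ⟩
  (sumTo n f + sumTo n g) + (f (suc n) + g (suc n))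
    ≡⟨ solve 4 (λ a b c d → (a :+ b) :+ (c :+ d) := (a :+ c) :+ (b :+ d)) refl
               (sumTo n f) (sumTo n g) (f (suc n)) (g (suc n)) ⟩
  (sumTo n f + f (suc n)) + (sumTo n g + g (suc n)) ∎

sumTo-- : ∀ n (f g : ℕ → ℤ) → sumTo n (λ i → f i - g i) ≡ sumTo n f - sumTo n g
sumTo-- zero    f g = refl
sumTo-- (suc n) f g = begin
  sumTo n (λ i → f i - g i) + (f (suc n) - g (suc n))
    ≡⟨ cong (_+ (f (suc n) - g (suc n))) (sumTo-- n f g) ⟩
  (sumTo n f - sumTo n g) + (f (suc n) - g (suc n))
    ≡⟨ solve 4 (λ a b c d → (a :- b) :+ (c :- d) := (a :+ c) :- (b :+ d)) refl
               (sumTo n f) (sumTo n g) (f (suc n)) (g (suc n)) ⟩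
  (sumTo n f + f (suc n)) - (sumTo n g + g (suc n)) ∎

sumTo-*ʳ : ∀ n (f : ℕ → ℤ) c → sumTo n (λ i → f i * c) ≡ sumTo n f * c
sumTo-*ʳ zero    f c = refl
sumTo-*ʳ (suc n) f c =
  trans (cong (_+ f (suc n) * c) (sumTo-*ʳ n f c)) (sym (ℤP.*-distribʳ-+ c (sumTo n f) (f (suc n))))

sumTo-unfoldˡ : ∀ n (f : ℕ → ℤ) → sumTo (suc n) f ≡ f 0 + sumTo n (f ∘ suc)
sumTo-unfoldˡ zero    f = refl
sumTo-unfoldˡ (suc n) f = begin
  sumTo (suc n) f + f (suc (suc n))
    ≡⟨ cong (_+ f (suc (suc n))) (sumTo-unfoldˡ n f) ⟩
  (f 0 + sumTo n (f ∘ suc)) + f (suc (suc n))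
    ≡⟨ ℤP.+-assoc (f 0) _ _ ⟩
  f 0 + sumTo (suc n) (f ∘ suc) ∎

sumTo-single : ∀ n a (f : ℕ → ℤ) → a ℕ.≤ n → (∀ i → i ℕ.≤ n → i ≢ a → f i ≡ 0ℤ) →
               sumTo n f ≡ f a
sumTo-single zero    zero f _   _   = refl
sumTo-single (suc n) a    f a≤n f≡0 with a ≟ suc n
... | yes refl = begin
  sumTo n f + f (suc n) ≡⟨ cong (_+ f (suc n)) (sumTo-zero n λ i i≤n →
                             f≡0 i (ℕP.m≤n⇒m≤1+n i≤n) (ℕP.<⇒≢ (s≤s i≤n))) ⟩
  0ℤ + f (suc n)        ≡⟨ ℤP.+-identityˡ (f (suc n)) ⟩
  f (suc n)             ∎
... | no a≢1+n = begin
  sumTo n f + f (suc n) ≡⟨ cong₂ _+_ (sumTo-single n a f (ℕP.≤-pred (ℕP.≤∧≢⇒< a≤n a≢1+n))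
                                         (λ i i≤n → f≡0 i (ℕP.m≤n⇒m≤1+n i≤n)))
                                     (f≡0 (suc n) ℕP.≤-refl (a≢1+n ∘ sym)) ⟩
  f a + 0ℤ              ≡⟨ ℤP.+-identityʳ (f a) ⟩
  f a                   ∎

sumTo-triangle : ∀ m (h : ℕ → ℕ → ℤ) →
  sumTo m (λ a → sumTo (m ∸ a) (h a)) ≡ sumTo m (λ s → sumTo s (λ a → h a (s ∸ a)))
sumTo-triangle zero    h = refl
sumTo-triangle (suc m) h = begin
  sumTo (suc m) (λ a → sumTo (suc m ∸ a) (h a))
    ≡⟨ sumTo-unfoldˡ m _ ⟩
  sumTo (suc m) (h 0) + sumTo m (λ a → sumTo (m ∸ a) (h (suc a)))
    ≡⟨ cong₂ _+_ (sumTo-unfoldˡ m (h 0)) (sumTo-triangle m (h ∘ suc)) ⟩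
  (h 0 0 + sumTo m (h 0 ∘ suc)) + sumTo m (λ s → sumTo s (λ a → h (suc a) (s ∸ a)))
    ≡⟨ ℤP.+-assoc (h 0 0) _ _ ⟩
  h 0 0 + (sumTo m (h 0 ∘ suc) + sumTo m (λ s → sumTo s (λ a → h (suc a) (s ∸ a))))
    ≡⟨ cong (λ z → h 0 0 + z) (sym (sumTo-+ m _ _)) ⟩
  h 0 0 + sumTo m (λ s → h 0 (suc s) + sumTo s (λ a → h (suc a) (s ∸ a)))
    ≡⟨ cong (λ z → h 0 0 + z) (sumTo-cong m λ s _ → sym (sumTo-unfoldˡ s (λ a → h a (suc s ∸ a)))) ⟩
  h 0 0 + sumTo m (λ s → sumTo (suc s) (λ a → h a (suc s ∸ a)))
    ≡⟨ sym (sumTo-unfoldˡ m _) ⟩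
  sumTo (suc m) (λ s → sumTo s (λ a → h a (s ∸ a))) ∎

sumBelow : ℕ → (ℕ → ℤ) → ℤ
sumBelow zero    f = 0ℤ
sumBelow (suc N) f = f 0 + sumBelow N (f ∘ suc)

sumBelow-cong : ∀ N {f g : ℕ → ℤ} → (∀ i → f i ≡ g i) → sumBelow N f ≡ sumBelow N g
sumBelow-cong zero    f≡g = refl
sumBelow-cong (suc N) f≡g = cong₂ _+_ (f≡g 0) (sumBelow-cong N (f≡g ∘ suc))

sumBelow-zero : ∀ N {f : ℕ → ℤ} → (∀ i → f i ≡ 0ℤ) → sumBelow N f ≡ 0ℤ
sumBelow-zero zero    f≡0 = refl
sumBelow-zero (suc N) f≡0 = cong₂ _+_ (f≡0 0) (sumBelow-zero N (f≡0 ∘ suc))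

sumBelow-truncate : ∀ N j (f : ℕ → ℤ) → j ℕ.< N → (∀ i → j ℕ.< i → f i ≡ 0ℤ) →
                    sumBelow N f ≡ sumTo j f
sumBelow-truncate (suc N) zero f _ f≡0 =
  trans (cong (λ z → f 0 + z) (sumBelow-zero N (λ i → f≡0 (suc i) (s≤s z≤n)))) (ℤP.+-identityʳ (f 0))
sumBelow-truncate (suc N) (suc j) f (s≤s j<N) f≡0 =
  trans (cong (λ z → f 0 + z) (sumBelow-truncate N j (f ∘ suc) j<N (λ i j<i → f≡0 (suc i) (s≤s j<i))))
        (sym (sumTo-unfoldˡ j f))

sumBelow-single : ∀ N j (f : ℕ → ℤ) → j ℕ.< N → (∀ i → i ≢ j → f i ≡ 0ℤ) → sumBelow N f ≡ f j
sumBelow-single (suc N) zero f _ f≡0 =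
  trans (cong (λ z → f 0 + z) (sumBelow-zero N (λ i → f≡0 (suc i) λ ()))) (ℤP.+-identityʳ (f 0))
sumBelow-single (suc N) (suc j) f (s≤s j<N) f≡0 =
  trans (cong₂ _+_ (f≡0 0 λ ())
                   (sumBelow-single N j (f ∘ suc) j<N (λ i i≢j → f≡0 (suc i) (i≢j ∘ ℕP.suc-injective))))
        (ℤP.+-identityˡ (f (suc j)))

-- Power series in one variable

shift : (ℕ → ℤ) → ℕ → ℤ
shift f zero    = 0ℤ
shift f (suc m) = f m

shift^ : ℕ → (ℕ → ℤ) → ℕ → ℤ
shift^ zero    f = f
shift^ (suc j) f = shift (shift^ j f)

δ₀ : ℕ → ℤ
δ₀ zero    = 1ℤ
δ₀ (suc _) = 0ℤ

shift-cong : ∀ {f g : ℕ → ℤ} → f ≗ g → shift f ≗ shift g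
shift-cong f≗g zero    = refl
shift-cong f≗g (suc m) = f≗g m

shift^-cong : ∀ j {f g : ℕ → ℤ} → f ≗ g → shift^ j f ≗ shift^ j g
shift^-cong zero    f≗g = f≗g
shift^-cong (suc j) f≗g = shift-cong (shift^-cong j f≗g)

shift^-zero : ∀ j m → shift^ j (λ _ → 0ℤ) m ≡ 0ℤ
shift^-zero zero    m       = refl
shift^-zero (suc j) zero    = refl
shift^-zero (suc j) (suc m) = shift^-zero j m

shift^-+ : ∀ j (f g : ℕ → ℤ) m → shift^ j (λ i → f i + g i) m ≡ shift^ j f m + shift^ j g m
shift^-+ zero    f g m       = refl
shift^-+ (suc j) f g zero    = refl
shift^-+ (suc j) f g (suc m) = shift^-+ j f g m

shift^-- : ∀ j (f g : ℕ → ℤ) m → shift^ j (λ i → f i - g i) m ≡ shift^ j f m - shift^ j g m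
shift^-- zero    f g m       = refl
shift^-- (suc j) f g zero    = refl
shift^-- (suc j) f g (suc m) = shift^-- j f g m

antidiagonalSum : (ℕ → ℕ → ℤ) → ℕ → ℤ
antidiagonalSum t n = sumTo n (λ i → t i (n ∸ i))

antidiagonalSum-shiftˡ : ∀ (t : ℕ → ℕ → ℤ) → (∀ r → t 0 r ≡ 0ℤ) →
                         antidiagonalSum t ≗ shift (antidiagonalSum (t ∘ suc))
antidiagonalSum-shiftˡ t t₀≡0 zero    = t₀≡0 0
antidiagonalSum-shiftˡ t t₀≡0 (suc n) = begin
  sumTo (suc n) (λ i → t i (suc n ∸ i))      ≡⟨ sumTo-unfoldˡ n _ ⟩
  t 0 (suc n) + antidiagonalSum (t ∘ suc) n  ≡⟨ cong (_+ antidiagonalSum (t ∘ suc) n) (t₀≡0 (suc n)) ⟩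
  0ℤ + antidiagonalSum (t ∘ suc) n           ≡⟨ ℤP.+-identityˡ _ ⟩
  antidiagonalSum (t ∘ suc) n                ∎

antidiagonalSum-shiftʳ : ∀ (t : ℕ → ℕ → ℤ) → (∀ i → t i 0 ≡ 0ℤ) →
                         antidiagonalSum t ≗ shift (antidiagonalSum (λ i r → t i (suc r)))
antidiagonalSum-shiftʳ t t₀≡0 zero    = t₀≡0 0
antidiagonalSum-shiftʳ t t₀≡0 (suc n) = begin
  sumTo n (λ i → t i (suc n ∸ i)) + t (suc n) (n ∸ n)
    ≡⟨ cong₂ _+_ (sumTo-cong n λ i i≤n → cong (t i) (ℕP.+-∸-assoc 1 i≤n))
                 (trans (cong (t (suc n)) (ℕP.n∸n≡0 n)) (t₀≡0 (suc n))) ⟩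
  antidiagonalSum (λ i r → t i (suc r)) n + 0ℤ
    ≡⟨ ℤP.+-identityʳ _ ⟩
  antidiagonalSum (λ i r → t i (suc r)) n ∎

conv : (ℕ → ℤ) → (ℕ → ℤ) → ℕ → ℤ
conv q f = antidiagonalSum (λ i r → q i * f r)

conv-congˡ : ∀ {q q'} f → q ≗ q' → conv q f ≗ conv q' f
conv-congˡ f q≗q' m = sumTo-cong m (λ i _ → cong (_* f (m ∸ i)) (q≗q' i))

conv-+ˡ : ∀ q r f m → conv (λ i → q i + r i) f m ≡ conv q f m + conv r f m
conv-+ˡ q r f m = trans (sumTo-cong m (λ i _ → ℤP.*-distribʳ-+ (f (m ∸ i)) (q i) (r i))) (sumTo-+ m _ _)

conv--ˡ : ∀ q r f m → conv (λ i → q i - r i) f m ≡ conv q f m - conv r f m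
conv--ˡ q r f m = trans (sumTo-cong m λ i _ →
    solve 3 (λ a b c → (a :- b) :* c := a :* c :- b :* c) refl (q i) (r i) (f (m ∸ i)))
  (sumTo-- m _ _)

conv-shift^ˡ : ∀ j q f → conv (shift^ j q) f ≗ shift^ j (conv q f)
conv-shift^ˡ zero    q f m = refl
conv-shift^ˡ (suc j) q f m =
  trans (antidiagonalSum-shiftˡ (λ i r → shift^ (suc j) q i * f r) (λ _ → refl) m)
        (shift-cong (conv-shift^ˡ j q f) m)

conv-δ₀ : ∀ f → conv δ₀ f ≗ f
conv-δ₀ f m = trans (sumTo-single m 0 _ z≤n δ₀-off) (ℤP.*-identityˡ (f m))
  where
  δ₀-off : ∀ i → i ℕ.≤ m → i ≢ 0 → δ₀ i * f (m ∸ i) ≡ 0ℤ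
  δ₀-off zero    _ 0≢0 = contradiction refl 0≢0
  δ₀-off (suc i) _ _   = refl

conv-shift^-δ₀ : ∀ j f → conv (shift^ j δ₀) f ≗ shift^ j f
conv-shift^-δ₀ j f m = trans (conv-shift^ˡ j δ₀ f m) (shift^-cong j (conv-δ₀ f) m)

-- Δ q is the product (1 - x)(1 - x²) q.
Δ : (ℕ → ℤ) → ℕ → ℤ
Δ q m = q m - shift^ 1 q m - shift^ 2 q m + shift^ 3 q m

Δ-shift : ∀ q → Δ (shift q) ≗ shift (Δ q)
Δ-shift q zero    = refl
Δ-shift q (suc m) = refl

Δ-factor : ∀ q m → Δ q m ≡ (q m - shift^ 2 q m) - shift (λ i → q i - shift^ 2 q i) m
Δ-factor q zero    = solve 1 (λ a → a :- con 0ℤ :- con 0ℤ :+ con 0ℤ := a :- con 0ℤ :- con 0ℤ) refl (q 0)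
Δ-factor q (suc m) = solve 4 (λ a b c d → a :- b :- c :+ d := (a :- c) :- (b :- d)) refl
                             (q (suc m)) (q m) (shift q m) (shift^ 2 q m)

conv-Δ : ∀ q f → conv (Δ q) f ≗ Δ (conv q f)
conv-Δ q f m = begin
  conv (Δ q) f m
    ≡⟨ conv-+ˡ (λ i → q i - shift^ 1 q i - shift^ 2 q i) (shift^ 3 q) f m ⟩
  conv (λ i → q i - shift^ 1 q i - shift^ 2 q i) f m + conv (shift^ 3 q) f m
    ≡⟨ cong (_+ conv (shift^ 3 q) f m) (trans (conv--ˡ (λ i → q i - shift^ 1 q i) (shift^ 2 q) f m)
                                              (cong (_- conv (shift^ 2 q) f m) (conv--ˡ q (shift^ 1 q) f m))) ⟩
  conv q f m - conv (shift^ 1 q) f m - conv (shift^ 2 q) f m + conv (shift^ 3 q) f m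
    ≡⟨ cong₂ _+_ (cong₂ _-_ (cong (λ z → conv q f m - z) (conv-shift^ˡ 1 q f m)) (conv-shift^ˡ 2 q f m))
                 (conv-shift^ˡ 3 q f m) ⟩
  Δ (conv q f) m ∎

-- Admissible pairs

+-cancelʳ-< : ∀ i j k → i + k < j + k → i < j
+-cancelʳ-< i j k lt = subst₂ _<_ (cancel i) (cancel j) (ℤP.+-monoˡ-< (- k) lt)
  where
  cancel : ∀ x → x + k + - k ≡ x
  cancel x = solve 2 (λ x k → x :+ k :+ :- k := x) refl x k

+-negsuc-< : ∀ m n M → + m + -[1+ M ] < + n ⇔ m ℕ.< n ℕ.+ suc M
+-negsuc-< m n M = mk⇔
  (λ lt → ℤP.drop‿+<+ (subst (_< + n + + suc M) add-back (ℤP.+-monoˡ-< (+ suc M) lt)))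
  (λ lt → +-cancelʳ-< _ _ (+ suc M) (subst (_< + n + + suc M) (sym add-back) (+<+ lt)))
  where
  add-back : + m + -[1+ M ] + + suc M ≡ + m
  add-back = solve 2 (λ x y → x :+ :- y :+ y := x) refl (+ m) (+ suc M)

-- Parts are stored decremented: admissible k a b is 1 iff (1 + a, 1 + b) can be a pair
-- (σ_{2i-1}, σ_{2i}) of a k-Arndt composition, pairSeries k s counts the admissible pairs of
-- weight s + 2, and borderPairs k s those among them having a part equal to 1.
admissible? : ∀ k a b → Dec (+ suc b + k < + suc a)
admissible? k a b = + suc b + k <? + suc a

admissible : ℤ → ℕ → ℕ → ℤ
admissible k a b = indicator (admissible? k a b)

pairSeries : ℤ → ℕ → ℤ
pairSeries k s = sumTo s (λ a → admissible k a (s ∸ a))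

borderPairs : ℤ → ℕ → ℤ
borderPairs k zero    = admissible k 0 0
borderPairs k (suc t) = admissible k 0 (suc t) + admissible k (suc t) 0

admissible-suc-suc : ∀ k a b → admissible k (suc a) (suc b) ≡ admissible k a b
admissible-suc-suc k a b = indicator-cong (admissible? k (suc a) (suc b)) (admissible? k a b)
  (λ lt → +-cancelʳ-< _ _ 1ℤ (subst₂ _<_ lhs rhs lt))
  (λ lt → subst₂ _<_ (sym lhs) (sym rhs) (ℤP.+-monoˡ-< 1ℤ lt))
  where
  lhs : + suc (suc b) + k ≡ + suc b + k + 1ℤ
  lhs = solve 2 (λ x y → (con 1ℤ :+ x) :+ y := x :+ y :+ con 1ℤ) refl (+ suc b) k
  rhs : + suc (suc a) ≡ + suc a + 1ℤ
  rhs = solve 1 (λ x → con 1ℤ :+ x := x :+ con 1ℤ) refl (+ suc a)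

pairSeries-suc-suc : ∀ k t → pairSeries k (2 ℕ.+ t) ≡ pairSeries k t + borderPairs k (2 ℕ.+ t)
pairSeries-suc-suc k t = begin
  sumTo (suc t) h + h (2 ℕ.+ t)
    ≡⟨ cong₂ _+_ (sumTo-unfoldˡ t h) (cong (admissible k (2 ℕ.+ t)) (ℕP.n∸n≡0 t)) ⟩
  (admissible k 0 (2 ℕ.+ t) + sumTo t (h ∘ suc)) + admissible k (2 ℕ.+ t) 0
    ≡⟨ cong (λ z → (admissible k 0 (2 ℕ.+ t) + z) + admissible k (2 ℕ.+ t) 0) (sumTo-cong t λ a a≤t →
         trans (cong (admissible k (suc a)) (ℕP.+-∸-assoc 1 a≤t)) (admissible-suc-suc k a (t ∸ a))) ⟩
  (admissible k 0 (2 ℕ.+ t) + pairSeries k t) + admissible k (2 ℕ.+ t) 0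
    ≡⟨ solve 3 (λ x p y → (x :+ p) :+ y := p :+ (x :+ y)) refl
               (admissible k 0 (2 ℕ.+ t)) (pairSeries k t) (admissible k (2 ℕ.+ t) 0) ⟩
  pairSeries k t + borderPairs k (2 ℕ.+ t) ∎
  where
  h : ℕ → ℤ
  h a = admissible k a (2 ℕ.+ t ∸ a)

pairSeries-shift² : ∀ k s → pairSeries k s - shift^ 2 (pairSeries k) s ≡ borderPairs k s
pairSeries-shift² k zero          = ℤP.+-identityʳ _
pairSeries-shift² k (suc zero)    = ℤP.+-identityʳ _
pairSeries-shift² k (suc (suc t)) =
  trans (cong (_- pairSeries k t) (pairSeries-suc-suc k t))
        (solve 2 (λ p b → p :+ b :- p := b) refl (pairSeries k t) (borderPairs k (2 ℕ.+ t)))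

Δ-pairSeries : ∀ k → Δ (pairSeries k) ≗ λ m → borderPairs k m - shift (borderPairs k) m
Δ-pairSeries k m = trans (Δ-factor (pairSeries k) m)
  (cong₂ _-_ (pairSeries-shift² k m) (shift-cong (pairSeries-shift² k) m))

admissible-nonneg-firstPart-1 : ∀ K b → admissible (+ K) 0 b ≡ 0ℤ
admissible-nonneg-firstPart-1 K b = indicator-no (admissible? (+ K) 0 b) λ { (+<+ (s≤s ())) }

admissible-nonneg-secondPart-1 : ∀ K a → admissible (+ K) a 0 ≡ indicator (K ℕ.<? a)
admissible-nonneg-secondPart-1 K a =
  indicator-cong (admissible? (+ K) a 0) (K ℕ.<? a) (ℕP.≤-pred ∘ ℤP.drop‿+<+) (+<+ ∘ s≤s)

admissible-neg-firstPart-1 : ∀ M b → admissible -[1+ M ] 0 b ≡ indicator (b ℕ.<? suc M)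
admissible-neg-firstPart-1 M b = indicator-cong (admissible? -[1+ M ] 0 b) (b ℕ.<? suc M)
  (ℕP.≤-pred ∘ Equivalence.to (+-negsuc-< (suc b) 1 M))
  (Equivalence.from (+-negsuc-< (suc b) 1 M) ∘ s≤s)

admissible-neg-secondPart-1 : ∀ M a → admissible -[1+ M ] a 0 ≡ 1ℤ
admissible-neg-secondPart-1 M a = indicator-yes (admissible? -[1+ M ] a 0) (Equivalence.from (+-negsuc-< 1 (suc a) M)
  (s≤s (ℕP.≤-trans (s≤s z≤n) (ℕP.m≤n+m (suc M) a))))

borderPairs-nonneg : ∀ K s → borderPairs (+ K) s ≡ indicator (K ℕ.<? s)
borderPairs-nonneg K zero    = admissible-nonneg-secondPart-1 K 0
borderPairs-nonneg K (suc t) =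
  trans (cong₂ _+_ (admissible-nonneg-firstPart-1 K (suc t)) (admissible-nonneg-secondPart-1 K (suc t)))
        (ℤP.+-identityˡ _)

borderPairs-neg : ∀ M t → borderPairs -[1+ M ] (suc t) ≡ indicator (suc t ℕ.<? suc M) + 1ℤ
borderPairs-neg M t = cong₂ _+_ (admissible-neg-firstPart-1 M (suc t)) (admissible-neg-secondPart-1 M (suc t))

indicator-<-stepʳ : ∀ K j → indicator (K ℕ.<? suc j) - indicator (K ℕ.<? j) ≡ shift^ K δ₀ j
indicator-<-stepʳ zero    zero    = refl
indicator-<-stepʳ zero    (suc j) = refl
indicator-<-stepʳ (suc K) zero    = refl
indicator-<-stepʳ (suc K) (suc j) = indicator-<-stepʳ K j

indicator-<-stepˡ : ∀ M j → indicator (suc j ℕ.<? M) - indicator (j ℕ.<? M) ≡ - shift^ M δ₀ (suc j)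
indicator-<-stepˡ zero          j       = refl
indicator-<-stepˡ (suc zero)    zero    = refl
indicator-<-stepˡ (suc (suc M)) zero    = refl
indicator-<-stepˡ (suc M)       (suc j) = indicator-<-stepˡ M j

Δ-pairSeries-nonneg : ∀ K → Δ (pairSeries (+ K)) ≗ shift^ (suc K) δ₀
Δ-pairSeries-nonneg K m = begin
  Δ (pairSeries (+ K)) m
    ≡⟨ Δ-pairSeries (+ K) m ⟩
  borderPairs (+ K) m - shift (borderPairs (+ K)) m
    ≡⟨ cong₂ _-_ (borderPairs-nonneg K m) (shift-cong (borderPairs-nonneg K) m) ⟩
  indicator (K ℕ.<? m) - shift (λ i → indicator (K ℕ.<? i)) m
    ≡⟨ step m ⟩
  shift^ (suc K) δ₀ m ∎
  where
  step : ∀ m → indicator (K ℕ.<? m) - shift (λ i → indicator (K ℕ.<? i)) m ≡ shift^ (suc K) δ₀ m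
  step zero    = trans (ℤP.+-identityʳ _) (indicator-no (K ℕ.<? 0) λ ())
  step (suc j) = indicator-<-stepʳ K j

Δ-pairSeries-neg : ∀ M → Δ (pairSeries -[1+ M ]) ≗ λ m → δ₀ m + shift δ₀ m - shift^ (suc M) δ₀ m
Δ-pairSeries-neg M m = trans (Δ-pairSeries -[1+ M ] m) (step m)
  where
  border₀ : borderPairs -[1+ M ] 0 ≡ 1ℤ
  border₀ = admissible-neg-secondPart-1 M 0
  step : ∀ m → borderPairs -[1+ M ] m - shift (borderPairs -[1+ M ]) m ≡
               δ₀ m + shift δ₀ m - shift^ (suc M) δ₀ m
  step zero          = cong (_- 0ℤ) border₀
  step (suc zero)    = begin
    borderPairs -[1+ M ] 1 - borderPairs -[1+ M ] 0
      ≡⟨ cong₂ _-_ (borderPairs-neg M 0) border₀ ⟩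
    (indicator (1 ℕ.<? suc M) + 1ℤ) - 1ℤ
      ≡⟨ solve 1 (λ a → (a :+ con 1ℤ) :- con 1ℤ := con 1ℤ :+ (a :- con 1ℤ)) refl
                 (indicator (1 ℕ.<? suc M)) ⟩
    1ℤ + (indicator (1 ℕ.<? suc M) - 1ℤ)
      ≡⟨ cong (λ z → 1ℤ + z) (indicator-<-stepˡ (suc M) 0) ⟩
    1ℤ - shift^ (suc M) δ₀ 1 ∎
  step (suc (suc j)) = begin
    borderPairs -[1+ M ] (2 ℕ.+ j) - borderPairs -[1+ M ] (suc j)
      ≡⟨ cong₂ _-_ (borderPairs-neg M (suc j)) (borderPairs-neg M j) ⟩
    (indicator (2 ℕ.+ j ℕ.<? suc M) + 1ℤ) - (indicator (suc j ℕ.<? suc M) + 1ℤ)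
      ≡⟨ solve 2 (λ a b → (a :+ con 1ℤ) :- (b :+ con 1ℤ) := a :- b) refl
               (indicator (2 ℕ.+ j ℕ.<? suc M)) (indicator (suc j ℕ.<? suc M)) ⟩
    indicator (2 ℕ.+ j ℕ.<? suc M) - indicator (suc j ℕ.<? suc M)
      ≡⟨ indicator-<-stepˡ (suc M) (suc j) ⟩
    - shift^ (suc M) δ₀ (2 ℕ.+ j)
      ≡⟨ sym (ℤP.+-identityˡ _) ⟩
    0ℤ + 0ℤ - shift^ (suc M) δ₀ (2 ℕ.+ j) ∎

-- Counting k-Arndt compositions

IsArndtOfWeight : ℤ → ℕ → List ℕ → Set
IsArndtOfWeight k m σ = sum σ ≡ m × Arndt k σ

isArndtOfWeight? : ∀ k m → Decidable (IsArndtOfWeight k m)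
isArndtOfWeight? k m σ = (sum σ ≟ m) ×-dec arndt? k σ

boxedCount : ℤ → ℕ → ℕ → ℕ → ℕ
boxedCount k N m ℓ = length (filter (isArndtOfWeight? k m) (boxLists ℓ N))

pairTerm : ℤ → (ℕ → ℤ) → ℕ → ℕ → ℕ → ℤ
pairTerm k f m a b = admissible k a b * (indicator (suc a ℕ.+ suc b ℕ.≤? m) * f (m ∸ (suc a ℕ.+ suc b)))

+-≡⇔≡∸ : ∀ {n m} s → n ℕ.≤ m → (n ℕ.+ s ≡ m ⇔ s ≡ m ∸ n)
+-≡⇔≡∸ {n} s n≤m = mk⇔ (λ e → trans (sym (ℕP.m+n∸m≡n n s)) (cong (_∸ n) e))
                        (λ e → trans (cong (n ℕ.+_) e) (ℕP.m+[n∸m]≡n n≤m))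

module _ {a p} {A : Set a} {P : Pred A p} (P? : Decidable P) where

  length-filter-[x] : ∀ x → + length (filter P? (x ∷ [])) ≡ indicator (P? x)
  length-filter-[x] x with P? x
  ... | yes _ = refl
  ... | no  _ = refl

  length-filter-concatMap : ∀ {b} {B : Set b} (g : B → List A) xs →
    length (filter P? (concatMap g xs)) ≡ sum (map (λ x → length (filter P? (g x))) xs)
  length-filter-concatMap g []       = refl
  length-filter-concatMap g (x ∷ xs) = begin
    length (filter P? (g x ++ concatMap g xs))
      ≡⟨ cong length (ListP.filter-++ P? (g x) (concatMap g xs)) ⟩
    length (filter P? (g x) ++ filter P? (concatMap g xs))
      ≡⟨ ListP.length-++ (filter P? (g x)) ⟩
    length (filter P? (g x)) ℕ.+ length (filter P? (concatMap g xs))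
      ≡⟨ cong (length (filter P? (g x)) ℕ.+_) (length-filter-concatMap g xs) ⟩
    sum (map (λ x → length (filter P? (g x))) (x ∷ xs)) ∎

  length-filter-map : ∀ {b} {B : Set b} (g : B → A) ys →
    length (filter P? (map g ys)) ≡ length (filter (P? ∘ g) ys)
  length-filter-map g []       = refl
  length-filter-map g (y ∷ ys) with P? (g y)
  ... | yes _ = cong suc (length-filter-map g ys)
  ... | no  _ = length-filter-map g ys

length-filter-boxLists-suc : ∀ {p} {P : Pred (List ℕ) p} (P? : Decidable P) ℓ N →
  + length (filter P? (boxLists (suc ℓ) N)) ≡
  sumBelow N (λ i → + length (filter (λ σ → P? (suc i ∷ σ)) (boxLists ℓ N)))
length-filter-boxLists-suc P? ℓ N =
  trans (cong +_ (length-filter-concatMap P? (λ i → map (i ∷_) (boxLists ℓ N)) (map suc (upTo N))))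
  (trans (sum-over-box _ N id)
         (sumBelow-cong N λ i → cong +_ (length-filter-map P? (suc i ∷_) (boxLists ℓ N))))
  where
  sum-over-box : ∀ (h : ℕ → ℕ) N f →
                 + sum (map h (map suc (applyUpTo f N))) ≡ sumBelow N (λ i → + h (suc (f i)))
  sum-over-box h zero    f = refl
  sum-over-box h (suc N) f = trans (ℤP.pos-+ (h (suc (f 0))) _)
                                   (cong (λ z → + h (suc (f 0)) + z) (sum-over-box h N (f ∘ suc)))

boxedCount-pair : ∀ k N m ℓ a b →
  + length (filter (λ σ → isArndtOfWeight? k m (suc a ∷ suc b ∷ σ)) (boxLists ℓ N)) ≡
  pairTerm k (λ r → + boxedCount k N r ℓ) m a b
boxedCount-pair k N m ℓ a b = split (admissible? k a b) (suc a ℕ.+ suc b ℕ.≤? m)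
  where
  Q? : Decidable (λ σ → IsArndtOfWeight k m (suc a ∷ suc b ∷ σ))
  Q? σ = isArndtOfWeight? k m (suc a ∷ suc b ∷ σ)
  reassoc : ∀ σ → suc a ℕ.+ suc b ℕ.+ sum σ ≡ sum (suc a ∷ suc b ∷ σ)
  reassoc σ = ℕP.+-assoc (suc a) (suc b) (sum σ)
  count-none : (∀ σ → ¬ IsArndtOfWeight k m (suc a ∷ suc b ∷ σ)) →
               + length (filter Q? (boxLists ℓ N)) ≡ 0ℤ
  count-none none = cong (+_ ∘ length) (ListP.filter-none Q? (universal none (boxLists ℓ N)))
  split : (adm : Dec (+ suc b + k < + suc a)) (fits : Dec (suc a ℕ.+ suc b ℕ.≤ m)) →
          + length (filter Q? (boxLists ℓ N)) ≡
          indicator adm * (indicator fits * + boxedCount k N (m ∸ (suc a ℕ.+ suc b)) ℓ)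
  split (no ¬adm) _          = count-none λ σ w → ¬adm (proj₁ (proj₂ w))
  split (yes adm) (no ¬fits) = count-none λ σ w →
    ¬fits (subst (suc a ℕ.+ suc b ℕ.≤_) (trans (reassoc σ) (proj₁ w)) (ℕP.m≤m+n _ (sum σ)))
  split (yes adm) (yes fits) = begin
    + length (filter Q? (boxLists ℓ N))
      ≡⟨ cong (+_ ∘ length) (ListP.filter-≐ Q? (isArndtOfWeight? k (m ∸ (suc a ℕ.+ suc b)))
           ( (λ { {σ} (e , _ , arndt) → Equivalence.to (weight σ) (trans (reassoc σ) e) , arndt })
           , (λ { {σ} (e , arndt) → trans (sym (reassoc σ)) (Equivalence.from (weight σ) e) , adm , arndt }))
           (boxLists ℓ N)) ⟩
    + boxedCount k N (m ∸ (suc a ℕ.+ suc b)) ℓ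
      ≡⟨ sym (trans (ℤP.*-identityˡ _) (ℤP.*-identityˡ _)) ⟩
    1ℤ * (1ℤ * + boxedCount k N (m ∸ (suc a ℕ.+ suc b)) ℓ) ∎
    where
    weight : ∀ σ → (suc a ℕ.+ suc b ℕ.+ sum σ ≡ m ⇔ sum σ ≡ m ∸ (suc a ℕ.+ suc b))
    weight σ = +-≡⇔≡∸ (sum σ) fits

suc+suc : ∀ a b → suc a ℕ.+ suc b ≡ 2 ℕ.+ (a ℕ.+ b)
suc+suc a b = cong suc (ℕP.+-suc a b)

pairTerm-congᶠ : ∀ k {f g : ℕ → ℤ} m a b → (∀ r → r ℕ.≤ m → f r ≡ g r) →
                 pairTerm k f m a b ≡ pairTerm k g m a b
pairTerm-congᶠ k m a b f≡g =
  cong (λ z → admissible k a b * (indicator (suc a ℕ.+ suc b ℕ.≤? m) * z))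
       (f≡g _ (ℕP.m∸n≤m m (suc a ℕ.+ suc b)))

pairTerm-heavy : ∀ k f m a b → ¬ (suc a ℕ.+ suc b ℕ.≤ m) → pairTerm k f m a b ≡ 0ℤ
pairTerm-heavy k f m a b ¬fits =
  trans (cong (λ z → admissible k a b * (z * f (m ∸ (suc a ℕ.+ suc b))))
              (indicator-no (suc a ℕ.+ suc b ℕ.≤? m) ¬fits))
        (ℤP.*-zeroʳ (admissible k a b))

pairTerm-light : ∀ k f m a b → a ℕ.+ b ℕ.≤ m →
                 pairTerm k f (2 ℕ.+ m) a b ≡ admissible k a b * f (m ∸ a ∸ b)
pairTerm-light k f m a b a+b≤m = cong (admissible k a b *_) (begin
  indicator (suc a ℕ.+ suc b ℕ.≤? 2 ℕ.+ m) * f (2 ℕ.+ m ∸ (suc a ℕ.+ suc b))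
    ≡⟨ cong₂ _*_ (indicator-yes (suc a ℕ.+ suc b ℕ.≤? 2 ℕ.+ m) fits)
                 (cong (λ z → f (2 ℕ.+ m ∸ z)) (suc+suc a b)) ⟩
  1ℤ * f (m ∸ (a ℕ.+ b))
    ≡⟨ ℤP.*-identityˡ _ ⟩
  f (m ∸ (a ℕ.+ b))
    ≡⟨ cong f (sym (ℕP.∸-+-assoc m a b)) ⟩
  f (m ∸ a ∸ b) ∎)
  where
  fits : suc a ℕ.+ suc b ℕ.≤ 2 ℕ.+ m
  fits = subst (ℕ._≤ 2 ℕ.+ m) (sym (suc+suc a b)) (s≤s (s≤s a+b≤m))

sumTo-triangle-conv : ∀ m (w : ℕ → ℕ → ℤ) f →
  sumTo m (λ a → sumTo (m ∸ a) (λ b → w a b * f (m ∸ a ∸ b))) ≡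
  conv (λ s → sumTo s (λ a → w a (s ∸ a))) f m
sumTo-triangle-conv m w f = begin
  sumTo m (λ a → sumTo (m ∸ a) (λ b → w a b * f (m ∸ a ∸ b)))
    ≡⟨ sumTo-triangle m (λ a b → w a b * f (m ∸ a ∸ b)) ⟩
  sumTo m (λ s → sumTo s (λ a → w a (s ∸ a) * f (m ∸ a ∸ (s ∸ a))))
    ≡⟨ sumTo-cong m (λ s _ → trans (sumTo-cong s λ a a≤s → cong (λ z → w a (s ∸ a) * f z) (∸-∸ a≤s))
                                   (sumTo-*ʳ s (λ a → w a (s ∸ a)) (f (m ∸ s)))) ⟩
  conv (λ s → sumTo s (λ a → w a (s ∸ a))) f m ∎
  where
  ∸-∸ : ∀ {a s} → a ℕ.≤ s → m ∸ a ∸ (s ∸ a) ≡ m ∸ s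
  ∸-∸ {a} {s} a≤s = trans (ℕP.∸-+-assoc m a (s ∸ a)) (cong (m ∸_) (ℕP.m+[n∸m]≡n a≤s))

2≤suc+suc : ∀ a b → 2 ℕ.≤ suc a ℕ.+ suc b
2≤suc+suc a b = ℕP.+-mono-≤ (s≤s (z≤n {a})) (s≤s (z≤n {b}))

sumBelow²-pairTerm : ∀ k f N m → m ℕ.≤ N →
  sumBelow N (λ a → sumBelow N (pairTerm k f m a)) ≡ shift^ 2 (conv (pairSeries k) f) m
sumBelow²-pairTerm k f N zero          _   = sumBelow-zero N λ a → sumBelow-zero N λ b →
  pairTerm-heavy k f 0 a b (ℕP.<⇒≱ (s≤s z≤n) ∘ ℕP.≤-trans (2≤suc+suc a b))
sumBelow²-pairTerm k f N (suc zero)    _   = sumBelow-zero N λ a → sumBelow-zero N λ b →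
  pairTerm-heavy k f 1 a b (ℕP.<⇒≱ (s≤s (s≤s z≤n)) ∘ ℕP.≤-trans (2≤suc+suc a b))
sumBelow²-pairTerm k f N (suc (suc m)) 2+m≤N = begin
  sumBelow N (λ a → sumBelow N (pairTerm k f (2 ℕ.+ m) a))
    ≡⟨ sumBelow-truncate N m _ m<N (λ a m<a → sumBelow-zero N λ b →
         pairTerm-heavy k f _ a b (ℕP.<⇒≱ m<a ∘ ℕP.m+n≤o⇒m≤o a ∘ light)) ⟩
  sumTo m (λ a → sumBelow N (pairTerm k f (2 ℕ.+ m) a))
    ≡⟨ sumTo-cong m (λ a a≤m → trans
         (sumBelow-truncate N (m ∸ a) _ (ℕP.≤-<-trans (ℕP.m∸n≤m m a) m<N) (λ b m∸a<b →
            pairTerm-heavy k f _ a b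
              (ℕP.<⇒≱ m∸a<b ∘ ℕP.m+n≤o⇒m≤o∸n b ∘ subst (ℕ._≤ m) (ℕP.+-comm a b) ∘ light)))
         (sumTo-cong (m ∸ a) λ b b≤m∸a → pairTerm-light k f m a b
            (subst (a ℕ.+ b ℕ.≤_) (ℕP.m+[n∸m]≡n a≤m) (ℕP.+-monoʳ-≤ a b≤m∸a)))) ⟩
  sumTo m (λ a → sumTo (m ∸ a) (λ b → admissible k a b * f (m ∸ a ∸ b)))
    ≡⟨ sumTo-triangle-conv m (admissible k) f ⟩
  conv (pairSeries k) f m ∎
  where
  m<N : m ℕ.< N
  m<N = ℕP.≤-trans (ℕP.n≤1+n (suc m)) 2+m≤N
  light : ∀ {a b} → suc a ℕ.+ suc b ℕ.≤ 2 ℕ.+ m → a ℕ.+ b ℕ.≤ m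
  light {a} {b} = ℕP.≤-pred ∘ ℕP.≤-pred ∘ subst (ℕ._≤ 2 ℕ.+ m) (suc+suc a b)

arndtCoeff : ℤ → FPS
arndtCoeff k n zero          = δ₀ n
arndtCoeff k n (suc zero)    = shift (λ _ → 1ℤ) n
arndtCoeff k n (suc (suc ℓ)) = shift^ 2 (conv (pairSeries k) (λ r → arndtCoeff k r ℓ)) n

boxedCount-one-part : ∀ k N m → m ℕ.≤ N → + boxedCount k N m 1 ≡ shift (λ _ → 1ℤ) m
boxedCount-one-part k N m m≤N = trans (length-filter-boxLists-suc (isArndtOfWeight? k m) 0 N) (count m m≤N)
  where
  term : ∀ m i → + length (filter (λ σ → isArndtOfWeight? k m (suc i ∷ σ)) ([] ∷ [])) ≡
                   indicator (suc i ℕ.+ 0 ≟ m)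
  term m i = trans (length-filter-[x] (λ σ → isArndtOfWeight? k m (suc i ∷ σ)) [])
                     (indicator-cong (isArndtOfWeight? k m (suc i ∷ [])) (suc i ℕ.+ 0 ≟ m) proj₁ (_, tt))
  count : ∀ m → m ℕ.≤ N →
          sumBelow N (λ i → + length (filter (λ σ → isArndtOfWeight? k m (suc i ∷ σ)) ([] ∷ []))) ≡
          shift (λ _ → 1ℤ) m
  count zero    _     = sumBelow-zero N λ i → trans (term 0 i) (indicator-no (suc i ℕ.+ 0 ≟ 0) λ ())
  count (suc m) m<N = trans (sumBelow-single N m _ m<N off)
                            (trans (term (suc m) m) (indicator-yes (suc m ℕ.+ 0 ≟ suc m) (ℕP.+-identityʳ (suc m))))
    where
    off : ∀ i → i ≢ m → + length (filter (λ σ → isArndtOfWeight? k (suc m) (suc i ∷ σ)) ([] ∷ [])) ≡ 0ℤ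
    off i i≢m = trans (term (suc m) i) (indicator-no (suc i ℕ.+ 0 ≟ suc m)
                        (i≢m ∘ ℕP.suc-injective ∘ trans (sym (ℕP.+-identityʳ (suc i)))))

boxedCount≡arndtCoeff : ∀ k ℓ N m → m ℕ.≤ N → + boxedCount k N m ℓ ≡ arndtCoeff k m ℓ
boxedCount≡arndtCoeff k zero          N zero    _   = refl
boxedCount≡arndtCoeff k zero          N (suc m) _   = refl
boxedCount≡arndtCoeff k (suc zero)    N m       m≤N = boxedCount-one-part k N m m≤N
boxedCount≡arndtCoeff k (suc (suc ℓ)) N m       m≤N = begin
  + boxedCount k N m (2 ℕ.+ ℓ)
    ≡⟨ length-filter-boxLists-suc (isArndtOfWeight? k m) (suc ℓ) N ⟩
  sumBelow N (λ a → + length (filter (λ σ → isArndtOfWeight? k m (suc a ∷ σ)) (boxLists (suc ℓ) N)))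
    ≡⟨ sumBelow-cong N (λ a → trans (length-filter-boxLists-suc (λ σ → isArndtOfWeight? k m (suc a ∷ σ)) ℓ N)
         (sumBelow-cong N λ b → trans (boxedCount-pair k N m ℓ a b) (pairTerm-congᶠ k m a b λ r r≤m →
            boxedCount≡arndtCoeff k ℓ N r (ℕP.≤-trans r≤m m≤N)))) ⟩
  sumBelow N (λ a → sumBelow N (pairTerm k (λ r → arndtCoeff k r ℓ) m a))
    ≡⟨ sumBelow²-pairTerm k (λ r → arndtCoeff k r ℓ) N m m≤N ⟩
  arndtCoeff k m (2 ℕ.+ ℓ) ∎

arndtGF≈arndtCoeff : ∀ k → arndtGF k ≈ₛ arndtCoeff k
arndtGF≈arndtCoeff k n ℓ = boxedCount≡arndtCoeff k ℓ n n ℕP.≤-refl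

-- Power series in two variables

≈ₛ-sym : ∀ {F G} → F ≈ₛ G → G ≈ₛ F
≈ₛ-sym F≈G n ℓ = sym (F≈G n ℓ)

≈ₛ-trans : ∀ {F G H} → F ≈ₛ G → G ≈ₛ H → F ≈ₛ H
≈ₛ-trans F≈G G≈H n ℓ = trans (F≈G n ℓ) (G≈H n ℓ)

*ₛ-congˡ : ∀ F {G G'} → G ≈ₛ G' → F *ₛ G ≈ₛ F *ₛ G'
*ₛ-congˡ F G≈G' n ℓ =
  sumTo-cong n λ i _ → sumTo-cong ℓ λ j _ → cong (F i j *_) (G≈G' (n ∸ i) (ℓ ∸ j))

*ₛ-congʳ : ∀ {F F'} G → F ≈ₛ F' → F *ₛ G ≈ₛ F' *ₛ G
*ₛ-congʳ G F≈F' n ℓ =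
  sumTo-cong n λ i _ → sumTo-cong ℓ λ j _ → cong (_* G (n ∸ i) (ℓ ∸ j)) (F≈F' i j)

*ₛ-distribˡ-+ₛ : ∀ F G H → F *ₛ (G +ₛ H) ≈ₛ F *ₛ G +ₛ F *ₛ H
*ₛ-distribˡ-+ₛ F G H n ℓ = trans (sumTo-cong n λ i _ →
    trans (sumTo-cong ℓ λ j _ → ℤP.*-distribˡ-+ (F i j) (G (n ∸ i) (ℓ ∸ j)) (H (n ∸ i) (ℓ ∸ j)))
          (sumTo-+ ℓ _ _))
  (sumTo-+ n _ _)

*ₛ-distribˡ--ₛ : ∀ F G H → F *ₛ (G -ₛ H) ≈ₛ F *ₛ G -ₛ F *ₛ H
*ₛ-distribˡ--ₛ F G H n ℓ = trans (sumTo-cong n λ i _ →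
    trans (sumTo-cong ℓ λ j _ → solve 3 (λ a b c → a :* (b :- c) := a :* b :- a :* c) refl
                                        (F i j) (G (n ∸ i) (ℓ ∸ j)) (H (n ∸ i) (ℓ ∸ j))) (sumTo-- ℓ _ _))
  (sumTo-- n _ _)

*ₛ-distribʳ--ₛ : ∀ F G H → (G -ₛ H) *ₛ F ≈ₛ G *ₛ F -ₛ H *ₛ F
*ₛ-distribʳ--ₛ F G H n ℓ = trans (sumTo-cong n λ i _ →
    trans (sumTo-cong ℓ λ j _ → solve 3 (λ a b c → (b :- c) :* a := b :* a :- c :* a) refl
                                        (F (n ∸ i) (ℓ ∸ j)) (G i j) (H i j)) (sumTo-- ℓ _ _))
  (sumTo-- n _ _)

oneₛ-off : ∀ r s → (r ≢ 0) ⊎ (s ≢ 0) → oneₛ r s ≡ 0ℤ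
oneₛ-off zero    zero    (inj₁ r≢0) = contradiction refl r≢0
oneₛ-off zero    zero    (inj₂ s≢0) = contradiction refl s≢0
oneₛ-off zero    (suc s) _          = refl
oneₛ-off (suc r) s       _          = refl

∸-≢0 : ∀ {i n} → i ℕ.≤ n → i ≢ n → n ∸ i ≢ 0
∸-≢0 i≤n i≢n n∸i≡0 = i≢n (ℕP.≤-antisym i≤n (ℕP.m∸n≡0⇒m≤n n∸i≡0))

*ₛ-identityˡ : ∀ F → oneₛ *ₛ F ≈ₛ F
*ₛ-identityˡ F n ℓ = begin
  (oneₛ *ₛ F) n ℓ
    ≡⟨ sumTo-single n 0 _ z≤n (λ i _ i≢0 → sumTo-zero ℓ λ j _ → off i j (inj₁ i≢0)) ⟩
  sumTo ℓ (λ j → oneₛ 0 j * F n (ℓ ∸ j))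
    ≡⟨ sumTo-single ℓ 0 _ z≤n (λ j _ j≢0 → off 0 j (inj₂ j≢0)) ⟩
  1ℤ * F n ℓ
    ≡⟨ ℤP.*-identityˡ (F n ℓ) ⟩
  F n ℓ ∎
  where
  off : ∀ i j → (i ≢ 0) ⊎ (j ≢ 0) → oneₛ i j * F (n ∸ i) (ℓ ∸ j) ≡ 0ℤ
  off i j ne = cong (_* F (n ∸ i) (ℓ ∸ j)) (oneₛ-off i j ne)

*ₛ-identityʳ : ∀ F → F *ₛ oneₛ ≈ₛ F
*ₛ-identityʳ F n ℓ = begin
  (F *ₛ oneₛ) n ℓ
    ≡⟨ sumTo-single n n _ ℕP.≤-refl (λ i i≤n i≢n →
         sumTo-zero ℓ λ j _ → off i j (inj₁ (∸-≢0 i≤n i≢n))) ⟩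
  sumTo ℓ (λ j → F n j * oneₛ (n ∸ n) (ℓ ∸ j))
    ≡⟨ sumTo-single ℓ ℓ _ ℕP.≤-refl (λ j j≤ℓ j≢ℓ → off n j (inj₂ (∸-≢0 j≤ℓ j≢ℓ))) ⟩
  F n ℓ * oneₛ (n ∸ n) (ℓ ∸ ℓ)
    ≡⟨ cong₂ (λ r s → F n ℓ * oneₛ r s) (ℕP.n∸n≡0 n) (ℕP.n∸n≡0 ℓ) ⟩
  F n ℓ * 1ℤ
    ≡⟨ ℤP.*-identityʳ (F n ℓ) ⟩
  F n ℓ ∎
  where
  off : ∀ i j → (n ∸ i ≢ 0) ⊎ (ℓ ∸ j ≢ 0) → F i j * oneₛ (n ∸ i) (ℓ ∸ j) ≡ 0ℤ
  off i j ne = trans (cong (F i j *_) (oneₛ-off (n ∸ i) (ℓ ∸ j) ne)) (ℤP.*-zeroʳ (F i j))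

-- x^a F and y^b F, written via rows and columns so that row ℓ of x^a F is definitionally
-- shift^ a of row ℓ of F.
xShift^ : ℕ → FPS → FPS
xShift^ a F n ℓ = shift^ a (λ m → F m ℓ) n

yShift^ : ℕ → FPS → FPS
yShift^ b F n = shift^ b (F n)

xShift^-cong : ∀ a {F G} → F ≈ₛ G → xShift^ a F ≈ₛ xShift^ a G
xShift^-cong a F≈G n ℓ = shift^-cong a (λ m → F≈G m ℓ) n

yShift^-cong : ∀ b {F G} → F ≈ₛ G → yShift^ b F ≈ₛ yShift^ b G
yShift^-cong b F≈G n = shift^-cong b (F≈G n)

sumTo-shift : ∀ n (g : ℕ → ℕ → ℤ) ℓ →
              sumTo n (λ i → shift (g i) ℓ) ≡ shift (λ ℓ' → sumTo n (λ i → g i ℓ')) ℓ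
sumTo-shift n g zero    = sumTo-zero n λ _ _ → refl
sumTo-shift n g (suc ℓ) = refl

xShift-*ₛ : ∀ F G → xShift^ 1 F *ₛ G ≈ₛ xShift^ 1 (F *ₛ G)
xShift-*ₛ F G n ℓ = antidiagonalSum-shiftˡ (λ i r → antidiagonalSum (λ j s → xShift^ 1 F i j * G r s) ℓ)
                                           (λ _ → sumTo-zero ℓ λ _ _ → refl) n

*ₛ-xShift : ∀ F G → F *ₛ xShift^ 1 G ≈ₛ xShift^ 1 (F *ₛ G)
*ₛ-xShift F G n ℓ = antidiagonalSum-shiftʳ (λ i r → antidiagonalSum (λ j s → F i j * xShift^ 1 G r s) ℓ)
                                           (λ i → sumTo-zero ℓ λ j _ → ℤP.*-zeroʳ (F i j)) n

yShift-*ₛ : ∀ F G → yShift^ 1 F *ₛ G ≈ₛ yShift^ 1 (F *ₛ G)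
yShift-*ₛ F G n ℓ = trans
  (sumTo-cong n λ i _ → antidiagonalSum-shiftˡ (λ j s → yShift^ 1 F i j * G (n ∸ i) s) (λ _ → refl) ℓ)
  (sumTo-shift n _ ℓ)

*ₛ-yShift : ∀ F G → F *ₛ yShift^ 1 G ≈ₛ yShift^ 1 (F *ₛ G)
*ₛ-yShift F G n ℓ = trans
  (sumTo-cong n λ i _ → antidiagonalSum-shiftʳ (λ j s → F i j * yShift^ 1 G (n ∸ i) s)
                                               (λ j → ℤP.*-zeroʳ (F i j)) ℓ)
  (sumTo-shift n _ ℓ)

xShift^-*ₛ : ∀ a F G → xShift^ a F *ₛ G ≈ₛ xShift^ a (F *ₛ G)
xShift^-*ₛ zero    F G _ _ = refl
xShift^-*ₛ (suc a) F G = ≈ₛ-trans (xShift-*ₛ (xShift^ a F) G) (xShift^-cong 1 (xShift^-*ₛ a F G))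

*ₛ-xShift^ : ∀ a F G → F *ₛ xShift^ a G ≈ₛ xShift^ a (F *ₛ G)
*ₛ-xShift^ zero    F G _ _ = refl
*ₛ-xShift^ (suc a) F G = ≈ₛ-trans (*ₛ-xShift F (xShift^ a G)) (xShift^-cong 1 (*ₛ-xShift^ a F G))

yShift^-*ₛ : ∀ b F G → yShift^ b F *ₛ G ≈ₛ yShift^ b (F *ₛ G)
yShift^-*ₛ zero    F G _ _ = refl
yShift^-*ₛ (suc b) F G = ≈ₛ-trans (yShift-*ₛ (yShift^ b F) G) (yShift^-cong 1 (yShift^-*ₛ b F G))

*ₛ-yShift^ : ∀ b F G → F *ₛ yShift^ b G ≈ₛ yShift^ b (F *ₛ G)
*ₛ-yShift^ zero    F G _ _ = refl
*ₛ-yShift^ (suc b) F G = ≈ₛ-trans (*ₛ-yShift F (yShift^ b G)) (yShift^-cong 1 (*ₛ-yShift^ b F G))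

Xₛ≈xShift : Xₛ ≈ₛ xShift^ 1 oneₛ
Xₛ≈xShift zero                ℓ       = refl
Xₛ≈xShift (suc zero)          zero    = refl
Xₛ≈xShift (suc zero)          (suc ℓ) = refl
Xₛ≈xShift (suc (suc n))       ℓ       = refl

Yₛ≈yShift : Yₛ ≈ₛ yShift^ 1 oneₛ
Yₛ≈yShift zero    zero          = refl
Yₛ≈yShift (suc n) zero          = refl
Yₛ≈yShift zero    (suc zero)    = refl
Yₛ≈yShift (suc n) (suc zero)    = refl
Yₛ≈yShift zero    (suc (suc ℓ)) = refl
Yₛ≈yShift (suc n) (suc (suc ℓ)) = refl

Xₛ-*ₛ : ∀ F → Xₛ *ₛ F ≈ₛ xShift^ 1 F
Xₛ-*ₛ F = ≈ₛ-trans (*ₛ-congʳ F Xₛ≈xShift) (≈ₛ-trans (xShift-*ₛ oneₛ F) (xShift^-cong 1 (*ₛ-identityˡ F)))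

Yₛ-*ₛ : ∀ F → Yₛ *ₛ F ≈ₛ yShift^ 1 F
Yₛ-*ₛ F = ≈ₛ-trans (*ₛ-congʳ F Yₛ≈yShift) (≈ₛ-trans (yShift-*ₛ oneₛ F) (yShift^-cong 1 (*ₛ-identityˡ F)))

Xₛ^≈xShift^ : ∀ a → Xₛ ^ₛ a ≈ₛ xShift^ a oneₛ
Xₛ^≈xShift^ zero    _ _ = refl
Xₛ^≈xShift^ (suc a) = ≈ₛ-trans (Xₛ-*ₛ (Xₛ ^ₛ a)) (xShift^-cong 1 (Xₛ^≈xShift^ a))

Yₛ^≈yShift^ : ∀ b → Yₛ ^ₛ b ≈ₛ yShift^ b oneₛ
Yₛ^≈yShift^ zero    _ _ = refl
Yₛ^≈yShift^ (suc b) = ≈ₛ-trans (Yₛ-*ₛ (Yₛ ^ₛ b)) (yShift^-cong 1 (Yₛ^≈yShift^ b))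

Xₛ^-*ₛ : ∀ a F → Xₛ ^ₛ a *ₛ F ≈ₛ xShift^ a F
Xₛ^-*ₛ a F =
  ≈ₛ-trans (*ₛ-congʳ F (Xₛ^≈xShift^ a)) (≈ₛ-trans (xShift^-*ₛ a oneₛ F) (xShift^-cong a (*ₛ-identityˡ F)))

Yₛ^-*ₛ : ∀ b F → Yₛ ^ₛ b *ₛ F ≈ₛ yShift^ b F
Yₛ^-*ₛ b F =
  ≈ₛ-trans (*ₛ-congʳ F (Yₛ^≈yShift^ b)) (≈ₛ-trans (yShift^-*ₛ b oneₛ F) (yShift^-cong b (*ₛ-identityˡ F)))

*ₛ-Xₛ : ∀ F → F *ₛ Xₛ ≈ₛ xShift^ 1 F
*ₛ-Xₛ F = ≈ₛ-trans (*ₛ-congˡ F Xₛ≈xShift) (≈ₛ-trans (*ₛ-xShift F oneₛ) (xShift^-cong 1 (*ₛ-identityʳ F)))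

*ₛ-Xₛ^ : ∀ F a → F *ₛ Xₛ ^ₛ a ≈ₛ xShift^ a F
*ₛ-Xₛ^ F a =
  ≈ₛ-trans (*ₛ-congˡ F (Xₛ^≈xShift^ a)) (≈ₛ-trans (*ₛ-xShift^ a F oneₛ) (xShift^-cong a (*ₛ-identityʳ F)))

*ₛ-Yₛ^ : ∀ F b → F *ₛ Yₛ ^ₛ b ≈ₛ yShift^ b F
*ₛ-Yₛ^ F b =
  ≈ₛ-trans (*ₛ-congˡ F (Yₛ^≈yShift^ b)) (≈ₛ-trans (*ₛ-yShift^ b F oneₛ) (yShift^-cong b (*ₛ-identityʳ F)))

*ₛ-Xₛ^-*ₛ : ∀ F a G → F *ₛ (Xₛ ^ₛ a *ₛ G) ≈ₛ xShift^ a (F *ₛ G)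
*ₛ-Xₛ^-*ₛ F a G = ≈ₛ-trans (*ₛ-congˡ F (Xₛ^-*ₛ a G)) (*ₛ-xShift^ a F G)

*ₛ-Yₛ^-*ₛ : ∀ F b G → F *ₛ (Yₛ ^ₛ b *ₛ G) ≈ₛ yShift^ b (F *ₛ G)
*ₛ-Yₛ^-*ₛ F b G = ≈ₛ-trans (*ₛ-congˡ F (Yₛ^-*ₛ b G)) (*ₛ-yShift^ b F G)

*ₛ-+ₛ-expand : ∀ F G H {G' H'} → F *ₛ G ≈ₛ G' → F *ₛ H ≈ₛ H' → F *ₛ (G +ₛ H) ≈ₛ G' +ₛ H'
*ₛ-+ₛ-expand F G H FG≈G' FH≈H' n ℓ =
  trans (*ₛ-distribˡ-+ₛ F G H n ℓ) (cong₂ _+_ (FG≈G' n ℓ) (FH≈H' n ℓ))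

*ₛ--ₛ-expand : ∀ F G H {G' H'} → F *ₛ G ≈ₛ G' → F *ₛ H ≈ₛ H' → F *ₛ (G -ₛ H) ≈ₛ G' -ₛ H'
*ₛ--ₛ-expand F G H FG≈G' FH≈H' n ℓ =
  trans (*ₛ-distribˡ--ₛ F G H n ℓ) (cong₂ _-_ (FG≈G' n ℓ) (FH≈H' n ℓ))

*ₛ-denomNonneg : ∀ F K →
  F *ₛ denomNonneg K ≈ₛ F -ₛ xShift^ 1 F -ₛ xShift^ 2 F +ₛ xShift^ 3 F -ₛ xShift^ (3 ℕ.+ K) (yShift^ 2 F)
*ₛ-denomNonneg F K =
  *ₛ--ₛ-expand F (oneₛ -ₛ Xₛ -ₛ Xₛ ^ₛ 2 +ₛ Xₛ ^ₛ 3) (Xₛ ^ₛ (3 ℕ.+ K) *ₛ Yₛ ^ₛ 2)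
    (*ₛ-+ₛ-expand F (oneₛ -ₛ Xₛ -ₛ Xₛ ^ₛ 2) (Xₛ ^ₛ 3)
      (*ₛ--ₛ-expand F (oneₛ -ₛ Xₛ) (Xₛ ^ₛ 2)
        (*ₛ--ₛ-expand F oneₛ Xₛ (*ₛ-identityʳ F) (*ₛ-Xₛ F))
        (*ₛ-Xₛ^ F 2))
      (*ₛ-Xₛ^ F 3))
    (≈ₛ-trans (*ₛ-Xₛ^-*ₛ F (3 ℕ.+ K) (Yₛ ^ₛ 2)) (xShift^-cong (3 ℕ.+ K) (*ₛ-Yₛ^ F 2)))

*ₛ-denomNeg : ∀ F M →
  F *ₛ denomNeg M ≈ₛ F -ₛ xShift^ 1 F -ₛ xShift^ 2 (F +ₛ yShift^ 2 F) +ₛ xShift^ 3 (F -ₛ yShift^ 2 F)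
                     +ₛ yShift^ 2 (xShift^ (2 ℕ.+ M) F)
*ₛ-denomNeg F M =
  *ₛ-+ₛ-expand F (d₂ +ₛ Xₛ ^ₛ 3 *ₛ (oneₛ -ₛ Yₛ ^ₛ 2)) (Yₛ ^ₛ 2 *ₛ Xₛ ^ₛ (2 ℕ.+ M))
    (*ₛ-+ₛ-expand F d₂ (Xₛ ^ₛ 3 *ₛ (oneₛ -ₛ Yₛ ^ₛ 2))
      (*ₛ--ₛ-expand F (oneₛ -ₛ Xₛ) (Xₛ ^ₛ 2 *ₛ (oneₛ +ₛ Yₛ ^ₛ 2))
        (*ₛ--ₛ-expand F oneₛ Xₛ (*ₛ-identityʳ F) (*ₛ-Xₛ F))
        (≈ₛ-trans (*ₛ-Xₛ^-*ₛ F 2 (oneₛ +ₛ Yₛ ^ₛ 2))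
                  (xShift^-cong 2 (*ₛ-+ₛ-expand F oneₛ (Yₛ ^ₛ 2) (*ₛ-identityʳ F) (*ₛ-Yₛ^ F 2)))))
      (≈ₛ-trans (*ₛ-Xₛ^-*ₛ F 3 (oneₛ -ₛ Yₛ ^ₛ 2))
                (xShift^-cong 3 (*ₛ--ₛ-expand F oneₛ (Yₛ ^ₛ 2) (*ₛ-identityʳ F) (*ₛ-Yₛ^ F 2)))))
    (≈ₛ-trans (*ₛ-Yₛ^-*ₛ F 2 (Xₛ ^ₛ (2 ℕ.+ M))) (yShift^-cong 2 (*ₛ-Xₛ^ F (2 ℕ.+ M))))
  where
  d₂ : FPS
  d₂ = oneₛ -ₛ Xₛ -ₛ Xₛ ^ₛ 2 *ₛ (oneₛ +ₛ Yₛ ^ₛ 2)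

-- The generating function

numerCoeff : FPS
numerCoeff 0 0 = 1ℤ
numerCoeff 1 0 = -1ℤ
numerCoeff 2 0 = -1ℤ
numerCoeff 3 0 = 1ℤ
numerCoeff 1 1 = 1ℤ
numerCoeff 3 1 = -1ℤ
numerCoeff _ _ = 0ℤ

numer≈numerCoeff : numer ≈ₛ numerCoeff
numer≈numerCoeff =
  ≈ₛ-trans (*ₛ-distribʳ--ₛ B oneₛ (Xₛ ^ₛ 2)) λ n ℓ →
  trans (cong₂ _-_ (trans (*ₛ-identityˡ B n ℓ) (B≈B' n ℓ))
                   (trans (Xₛ^-*ₛ 2 B n ℓ) (xShift^-cong 2 B≈B' n ℓ)))
        (expand n ℓ)
  where
  B B' : FPS
  B  = oneₛ -ₛ Xₛ *ₛ (oneₛ -ₛ Yₛ)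
  B' = oneₛ -ₛ xShift^ 1 (oneₛ -ₛ Yₛ)
  B≈B' : B ≈ₛ B'
  B≈B' n ℓ = cong (λ z → oneₛ n ℓ - z) (Xₛ-*ₛ (oneₛ -ₛ Yₛ) n ℓ)
  expand : B' -ₛ xShift^ 2 B' ≈ₛ numerCoeff
  expand 0 0                 = refl
  expand 0 1                 = refl
  expand 0 (suc (suc ℓ))     = refl
  expand 1 0                 = refl
  expand 1 1                 = refl
  expand 1 (suc (suc ℓ))     = refl
  expand 2 0                 = refl
  expand 2 1                 = refl
  expand 2 (suc (suc ℓ))     = refl
  expand 3 0                 = refl
  expand 3 1                 = refl
  expand 3 (suc (suc ℓ))     = refl
  expand (suc (suc (suc (suc n)))) ℓ = refl

numerCoeff-high : ∀ n ℓ → numerCoeff n (2 ℕ.+ ℓ) ≡ 0ℤ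
numerCoeff-high 0                         ℓ = refl
numerCoeff-high 1                         ℓ = refl
numerCoeff-high 2                         ℓ = refl
numerCoeff-high 3                         ℓ = refl
numerCoeff-high (suc (suc (suc (suc n)))) ℓ = refl

Δ-arndtCoeff-row₀ : ∀ k n → Δ (λ m → arndtCoeff k m 0) n ≡ numerCoeff n 0
Δ-arndtCoeff-row₀ k 0                         = refl
Δ-arndtCoeff-row₀ k 1                         = refl
Δ-arndtCoeff-row₀ k 2                         = refl
Δ-arndtCoeff-row₀ k 3                         = refl
Δ-arndtCoeff-row₀ k (suc (suc (suc (suc n)))) = refl

Δ-arndtCoeff-row₁ : ∀ k n → Δ (λ m → arndtCoeff k m 1) n ≡ numerCoeff n 1
Δ-arndtCoeff-row₁ k 0                         = refl
Δ-arndtCoeff-row₁ k 1                         = refl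
Δ-arndtCoeff-row₁ k 2                         = refl
Δ-arndtCoeff-row₁ k 3                         = refl
Δ-arndtCoeff-row₁ k (suc (suc (suc (suc n)))) = refl

Δ-arndtCoeff-row : ∀ k ℓ →
  Δ (λ m → arndtCoeff k m (2 ℕ.+ ℓ)) ≗ shift^ 2 (conv (Δ (pairSeries k)) (λ m → arndtCoeff k m ℓ))
Δ-arndtCoeff-row k ℓ n = begin
  Δ (shift (shift g)) n     ≡⟨ Δ-shift (shift g) n ⟩
  shift (Δ (shift g)) n     ≡⟨ shift-cong (Δ-shift g) n ⟩
  shift (shift (Δ g)) n     ≡⟨ shift^-cong 2 (sym ∘ conv-Δ (pairSeries k) f) n ⟩
  shift^ 2 (conv (Δ (pairSeries k)) f) n ∎
  where
  f g : ℕ → ℤ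
  f m = arndtCoeff k m ℓ
  g   = conv (pairSeries k) f

conv-Δ-pairSeries-nonneg : ∀ K f → conv (Δ (pairSeries (+ K))) f ≗ shift^ (suc K) f
conv-Δ-pairSeries-nonneg K f m =
  trans (conv-congˡ f (Δ-pairSeries-nonneg K) m) (conv-shift^-δ₀ (suc K) f m)

conv-Δ-pairSeries-neg : ∀ M f → conv (Δ (pairSeries -[1+ M ])) f ≗ λ m → f m + shift f m - shift^ (suc M) f m
conv-Δ-pairSeries-neg M f m = begin
  conv (Δ (pairSeries -[1+ M ])) f m
    ≡⟨ conv-congˡ f (Δ-pairSeries-neg M) m ⟩
  conv (λ i → δ₀ i + shift δ₀ i - shift^ (suc M) δ₀ i) f m
    ≡⟨ conv--ˡ (λ i → δ₀ i + shift δ₀ i) (shift^ (suc M) δ₀) f m ⟩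
  conv (λ i → δ₀ i + shift δ₀ i) f m - conv (shift^ (suc M) δ₀) f m
    ≡⟨ cong₂ _-_ (trans (conv-+ˡ δ₀ (shift δ₀) f m) (cong₂ _+_ (conv-δ₀ f m) (conv-shift^-δ₀ 1 f m)))
                 (conv-shift^-δ₀ (suc M) f m) ⟩
  f m + shift f m - shift^ (suc M) f m ∎

Δ-arndtCoeff-nonneg : ∀ K ℓ →
  Δ (λ m → arndtCoeff (+ K) m (2 ℕ.+ ℓ)) ≗ shift^ (3 ℕ.+ K) (λ m → arndtCoeff (+ K) m ℓ)
Δ-arndtCoeff-nonneg K ℓ n =
  trans (Δ-arndtCoeff-row (+ K) ℓ n) (shift^-cong 2 (conv-Δ-pairSeries-nonneg K (λ m → arndtCoeff (+ K) m ℓ)) n)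

Δ-arndtCoeff-neg : ∀ M ℓ → let f = λ m → arndtCoeff -[1+ M ] m ℓ in
  Δ (λ m → arndtCoeff -[1+ M ] m (2 ℕ.+ ℓ)) ≗ λ n → shift^ 2 f n + shift^ 3 f n - shift^ (3 ℕ.+ M) f n
Δ-arndtCoeff-neg M ℓ n = begin
  Δ (λ m → arndtCoeff -[1+ M ] m (2 ℕ.+ ℓ)) n
    ≡⟨ Δ-arndtCoeff-row -[1+ M ] ℓ n ⟩
  shift^ 2 (conv (Δ (pairSeries -[1+ M ])) f) n
    ≡⟨ shift^-cong 2 (conv-Δ-pairSeries-neg M f) n ⟩
  shift^ 2 (λ m → f m + shift f m - shift^ (suc M) f m) n
    ≡⟨ trans (shift^-- 2 (λ m → f m + shift f m) (shift^ (suc M) f) n)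
             (cong (_- shift^ (3 ℕ.+ M) f n) (shift^-+ 2 f (shift f) n)) ⟩
  shift^ 2 f n + shift^ 3 f n - shift^ (3 ℕ.+ M) f n ∎
  where
  f : ℕ → ℤ
  f m = arndtCoeff -[1+ M ] m ℓ

arndtCoeff-*ₛ-denomNonneg : ∀ K → arndtCoeff (+ K) *ₛ denomNonneg K ≈ₛ numerCoeff
arndtCoeff-*ₛ-denomNonneg K = ≈ₛ-trans (*ₛ-denomNonneg C K) rows
  where
  C : FPS
  C = arndtCoeff (+ K)
  rows : C -ₛ xShift^ 1 C -ₛ xShift^ 2 C +ₛ xShift^ 3 C -ₛ xShift^ (3 ℕ.+ K) (yShift^ 2 C) ≈ₛ numerCoeff
  rows n 0 = trans (cong (λ z → Δ (λ m → C m 0) n - z) (shift^-zero (3 ℕ.+ K) n))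
                   (trans (ℤP.+-identityʳ _) (Δ-arndtCoeff-row₀ (+ K) n))
  rows n 1 = trans (cong (λ z → Δ (λ m → C m 1) n - z) (shift^-zero (3 ℕ.+ K) n))
                   (trans (ℤP.+-identityʳ _) (Δ-arndtCoeff-row₁ (+ K) n))
  rows n (suc (suc ℓ)) = begin
    Δ (λ m → C m (2 ℕ.+ ℓ)) n - shift^ (3 ℕ.+ K) f n
      ≡⟨ cong (_- shift^ (3 ℕ.+ K) f n) (Δ-arndtCoeff-nonneg K ℓ n) ⟩
    shift^ (3 ℕ.+ K) f n - shift^ (3 ℕ.+ K) f n
      ≡⟨ ℤP.+-inverseʳ (shift^ (3 ℕ.+ K) f n) ⟩
    0ℤ
      ≡⟨ sym (numerCoeff-high n ℓ) ⟩
    numerCoeff n (2 ℕ.+ ℓ) ∎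
    where
    f : ℕ → ℤ
    f m = C m ℓ

arndtCoeff-*ₛ-denomNeg : ∀ M → arndtCoeff -[1+ M ] *ₛ denomNeg (suc M) ≈ₛ numerCoeff
arndtCoeff-*ₛ-denomNeg M = ≈ₛ-trans (*ₛ-denomNeg C (suc M)) rows
  where
  C : FPS
  C = arndtCoeff -[1+ M ]
  rows : C -ₛ xShift^ 1 C -ₛ xShift^ 2 (C +ₛ yShift^ 2 C) +ₛ xShift^ 3 (C -ₛ yShift^ 2 C)
           +ₛ yShift^ 2 (xShift^ (3 ℕ.+ M) C) ≈ₛ numerCoeff
  rows 0                         0 = refl
  rows 1                         0 = refl
  rows 2                         0 = refl
  rows 3                         0 = refl
  rows (suc (suc (suc (suc n)))) 0 = refl
  rows 0                         1 = refl
  rows 1                         1 = refl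
  rows 2                         1 = refl
  rows 3                         1 = refl
  rows (suc (suc (suc (suc n)))) 1 = refl
  rows n (suc (suc ℓ)) = begin
    r n - shift r n - shift^ 2 (λ m → r m + f m) n + shift^ 3 (λ m → r m - f m) n + shift^ (3 ℕ.+ M) f n
      ≡⟨ cong₂ (λ u v → r n - shift r n - u + v + shift^ (3 ℕ.+ M) f n) (shift^-+ 2 r f n) (shift^-- 3 r f n) ⟩
    r n - shift r n - (shift^ 2 r n + shift^ 2 f n) + (shift^ 3 r n - shift^ 3 f n) + shift^ (3 ℕ.+ M) f n
      ≡⟨ solve 7 (λ r₀ r₁ r₂ r₃ f₂ f₃ fₘ → r₀ :- r₁ :- (r₂ :+ f₂) :+ (r₃ :- f₃) :+ fₘ
                                          := (r₀ :- r₁ :- r₂ :+ r₃) :- (f₂ :+ f₃ :- fₘ)) refl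
           (r n) (shift r n) (shift^ 2 r n) (shift^ 3 r n) (shift^ 2 f n) (shift^ 3 f n) (shift^ (3 ℕ.+ M) f n) ⟩
    Δ r n - (shift^ 2 f n + shift^ 3 f n - shift^ (3 ℕ.+ M) f n)
      ≡⟨ cong (_- (shift^ 2 f n + shift^ 3 f n - shift^ (3 ℕ.+ M) f n)) (Δ-arndtCoeff-neg M ℓ n) ⟩
    (shift^ 2 f n + shift^ 3 f n - shift^ (3 ℕ.+ M) f n) - (shift^ 2 f n + shift^ 3 f n - shift^ (3 ℕ.+ M) f n)
      ≡⟨ ℤP.+-inverseʳ (shift^ 2 f n + shift^ 3 f n - shift^ (3 ℕ.+ M) f n) ⟩
    0ℤ
      ≡⟨ sym (numerCoeff-high n ℓ) ⟩
    numerCoeff n (2 ℕ.+ ℓ) ∎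
    where
    r f : ℕ → ℤ
    r m = C m (2 ℕ.+ ℓ)
    f m = C m ℓ

theorem4p1 : (k : ℤ) →
    (0ℤ ≤ k → arndtGF k *ₛ denomNonneg ∣ k ∣ ≈ₛ numer) ×
    (k < 0ℤ → arndtGF k *ₛ denomNeg ∣ k ∣ ≈ₛ numer)
theorem4p1 (+ K) =
    (λ _ → ≈ₛ-trans (*ₛ-congʳ (denomNonneg K) (arndtGF≈arndtCoeff (+ K)))
             (≈ₛ-trans (arndtCoeff-*ₛ-denomNonneg K) (≈ₛ-sym numer≈numerCoeff)))
  , λ { (+<+ ()) }
theorem4p1 -[1+ M ] =
    (λ ())
  , (λ _ → ≈ₛ-trans (*ₛ-congʳ (denomNeg (suc M)) (arndtGF≈arndtCoeff -[1+ M ]))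
             (≈ₛ-trans (arndtCoeff-*ₛ-denomNeg M) (≈ₛ-sym numer≈numerCoeff)))
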